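{- Let $\sigma$ be a finite relational signature and let $\mathcal A$ be a finite $\sigma$-structure, regarded as a $1$-coloured structure (every element has colour $0$). Then \[ \operatorname{ucw}(\mathcal A)\leq \operatorname{pw}(G_{\mathcal A})+2, \] where $G_{\mathcal A}$ is the Gaifman graph of $\mathcal A$ and $\operatorname{pw}$ denotes path-width.
   Context: A signature $\sigma$ is a finite set of relation symbols, each with an arity; all structures are finite. The Gaifman graph $G_{\mathcal A}$ of a structure $\mathcal A$ has the universe $A$ as vertex set, and two distinct elements are adjacent iff they occur together in some tuple of some relation of $\mathcal A$. Path-width is defined as usual (maximum bag size minus one, minimised over path decompositions). A coloured structure is a pair $(\mathcal A,\gamma)$ with $\gamma\colon A\to\omega$; it is $k$-coloured if $\gamma(A)\subseteq\{0,\dots,k-1\}$. A (plain) structure is identified with the $1$-coloured structure in which every element has colour $0$. For a non-negative integer $k$, $\mathrm{UCW}_k[\sigma]$ is the smallest class of $k$-coloured $\sigma$-structures such that: (1) every empty $\sigma$-structure (1-coloured) is in it; (2) every $1$-element $\sigma$-structure with all relations empty (1-coloured) is in it; (3) it is closed under disjoint union $(\mathcal A\sqcup\mathcal B,\gamma_A\sqcup\gamma_B)$; (4) if $(\mathcal A,\gamma)$ is in it and $f\colon\{0,\dots,k-1\}\to\{0,\dots,k-1\}$ is any function, then $(\mathcal A,f\circ\gamma)$ is in it; (5) if $(\mathcal A,\gamma)$ is in it, $R\in\sigma$ is $n$-ary and $c_0,\dots,c_{n-1}\in\{0,\dots,k-1\}$, then $(\mathcal B,\gamma)$ is in it, where $\mathcal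 B$ is like $\mathcal A$ except that $\mathcal B\models R(a_0,\dots,a_{n-1})$ iff $\mathcal A\models R(a_0,\dots,a_{n-1})$ or $\gamma(a_i)=c_i$ for all $i<n$. The unary clique-width $\operatorname{ucw}(\mathcal A)$ is the smallest $k$ with $\mathcal A\in\mathrm{UCW}_k[\sigma]$. -}

module Defs where

open import Data.Nat using (ℕ; zero; suc; _+_; _∸_; _≤_; _⊔_)
open import Data.Fin using (Fin; zero; suc; toℕ; splitAt; _≟_)
import Data.Fin as F
open import Data.Fin.Properties using (all?)
open import Data.Fin.Subset using (Subset; ∣_∣) renaming (_∈_ to _∈ₛ_)
open import Data.Bool using (Bool; true; false; _∨_)
open import Data.Maybe using (Maybe; just; nothing; maybe)
open import Data.Sum using (_⊎_; inj₁; inj₂)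
open import Data.Product using (Σ; Σ-syntax; ∃; ∃-syntax; _×_; _,_)
open import Function using (_∘_)
open import Function.Bundles using (_↔_; Inverse)
open import Relation.Nullary using (¬_; yes; no)
open import Relation.Nullary.Decidable using (⌊_⌋)
open import Relation.Binary.PropositionalEquality using (_≡_; refl)

record Sig : Set where
  field
    nsym : ℕ
    ar   : Fin nsym → ℕ
open Sig public

record Str (σ : Sig) : Set where
  field
    size : ℕ
    rel  : (R : Fin (nsym σ)) → (Fin (ar σ R) → Fin size) → Bool
open Str public

Col : ∀ {σ} → Str σ → ℕ → Set
Col A k = Fin (size A) → Fin k

allJust : ∀ {X : Set} (a : ℕ) → (Fin a → Maybe X) → Maybe (Fin a → X)
allJust zero    t = just (λ ())
allJust (suc a) t with t zero | allJust a (t ∘ suc)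
... | just x | just f = just (λ { zero → x ; (suc i) → f i })
... | _      | _      = nothing

leftOf : ∀ n m → Fin (n + m) → Maybe (Fin n)
leftOf n m x with splitAt n x
... | inj₁ y = just y
... | inj₂ _ = nothing

rightOf : ∀ n m → Fin (n + m) → Maybe (Fin m)
rightOf n m x with splitAt n x
... | inj₁ _ = nothing
... | inj₂ y = just y

_⊔ˢ_ : ∀ {σ} → Str σ → Str σ → Str σ
_⊔ˢ_ {σ} A B = record
  { size = size A + size B
  ; rel  = λ R t →
      maybe (rel A R) false (allJust (ar σ R) (leftOf (size A) (size B) ∘ t))
      ∨ maybe (rel B R) false (allJust (ar σ R) (rightOf (size A) (size B) ∘ t)) }

_⊔ᶜ_ : ∀ {σ} {A B : Str σ} {k} → Col A k → Col B k → Col (A ⊔ˢ B) k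
_⊔ᶜ_ {A = A} γ δ x with splitAt (size A) x
... | inj₁ y = γ y
... | inj₂ y = δ y

agrees : ∀ {k} (n : ℕ) → (Fin n → Fin k) → (Fin n → Fin k) → Bool
agrees n u c = ⌊ all? (λ i → u i ≟ c i) ⌋

addRelRel : ∀ {σ} (A : Str σ) {k} (γ : Col A k) (R : Fin (nsym σ)) (c : Fin (ar σ R) → Fin k)
  → (R' : Fin (nsym σ)) → (Fin (ar σ R') → Fin (size A)) → Bool
addRelRel {σ} A γ R c R' t with R' ≟ R
... | yes refl = rel A R t ∨ agrees (ar σ R) (γ ∘ t) c
... | no _     = rel A R' t

addRel : ∀ {σ} (A : Str σ) {k} (γ : Col A k) (R : Fin (nsym σ)) (c : Fin (ar σ R) → Fin k) → Str σ
addRel A γ R c = record { size = size A ; rel = addRelRel A γ R c }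

data UCW {σ : Sig} (k : ℕ) : (A : Str σ) → Col A k → Set where
  ucw-empty : (A : Str σ) (γ : Col A k) → size A ≡ 0 → UCW k A γ
  ucw-single : (A : Str σ) (γ : Col A k) → size A ≡ 1
    → (∀ R t → rel A R t ≡ false) → (∀ a → toℕ (γ a) ≡ 0) → UCW k A γ
  ucw-union : ∀ {A B γ δ} → UCW k A γ → UCW k B δ → UCW k (A ⊔ˢ B) (_⊔ᶜ_ {A = A} {B = B} γ δ)
  ucw-recolour : ∀ {A γ} → UCW k A γ → (f : Fin k → Fin k) → UCW k A (f ∘ γ)
  ucw-addRel : ∀ {A γ} → UCW k A γ → (R : Fin (nsym σ)) (c : Fin (ar σ R) → Fin k)
    → UCW k (addRel A γ R c) γ
  ucw-iso : ∀ {A B γ δ} → UCW k A γ → (e : Fin (size A) ↔ Fin (size B))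
    → (∀ R t → rel B R (Inverse.to e ∘ t) ≡ rel A R t)
    → (∀ a → δ (Inverse.to e a) ≡ γ a)
    → UCW k B δ

InUCW : ∀ {σ} → ℕ → Str σ → Set
InUCW k A = Σ[ γ ∈ Col A k ] ((∀ a → toℕ (γ a) ≡ 0) × UCW k A γ)

IsUCW : ∀ {σ} → Str σ → ℕ → Set
IsUCW A k = InUCW k A × (∀ k' → InUCW k' A → k ≤ k')

record Graph : Set₁ where
  field
    V   : ℕ
    Adj : Fin V → Fin V → Set
open Graph public

Gaifman : ∀ {σ} → Str σ → Graph
Gaifman {σ} A = record
  { V   = size A
  ; Adj = λ a b → ¬ (a ≡ b) × (Σ[ R ∈ Fin (nsym σ) ] Σ[ t ∈ (Fin (ar σ R) → Fin (size A)) ]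
            (rel A R t ≡ true × (∃[ i ] t i ≡ a) × (∃[ j ] t j ≡ b))) }

record PathDecomposition (G : Graph) : Set where
  field
    len    : ℕ
    bag    : Fin len → Subset (V G)
    covers : ∀ v → ∃[ i ] v ∈ₛ bag i
    edges  : ∀ u v → Adj G u v → ∃[ i ] (u ∈ₛ bag i × v ∈ₛ bag i)
    interval : ∀ v (i j l : Fin len) → i F.≤ j → j F.≤ l
      → v ∈ₛ bag i → v ∈ₛ bag l → v ∈ₛ bag j
open PathDecomposition public

maxOver : (n : ℕ) → (Fin n → ℕ) → ℕ
maxOver zero    f = 0
maxOver (suc n) f = f zero ⊔ maxOver n (f ∘ suc)

-- width = (maximum bag size) - 1   (truncated at 0)
width : ∀ {G} → PathDecomposition G → ℕ
width D = maxOver (len D) (λ i → ∣ bag D i ∣) ∸ 1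

IsPathWidth : Graph → ℕ → Set
IsPathWidth G p = (Σ[ D ∈ PathDecomposition G ] width D ≡ p)
                × (∀ (D : PathDecomposition G) → p ≤ width D)

module Submission where

-- Fix a path decomposition B_0, …, B_{L-1} of the Gaifman graph whose bags have
-- at most p + 1 elements, and let first(x) be the least index of a bag
-- containing x.  Colour 0 means "retired"; colour 1 + i names the element of
-- rank i in the current bag.  Elements are added one at a time in order of
-- first(x).  When x is added, with new current bag B = B_{first(x)},
--   (i)   the structure built so far is recoloured from ranks in the old bag to
--         ranks in B; this is a function of the old colours because, by the
--         interval property, a retired element never enters a later bag;
--   (ii)  x is adjoined as an isolated point with its colour;
--   (iii) every tuple through x is added by its colour pattern (rule (5)).
-- A tuple through x lies inside B, where colours are injective, so (iii) adds
-- exactly the intended tuples.  Finally everything is recoloured to 0.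

open import Defs
open import Data.Bool using (Bool; true; false; _∨_; _∧_; not; if_then_else_)
open import Data.Bool.Properties using (∨-identityʳ; ∨-zeroʳ)
open import Data.Empty using (⊥-elim)
open import Data.Fin using (Fin; zero; suc; toℕ; fromℕ<; splitAt; _≟_; _↑ˡ_)
import Data.Fin as Fin
open import Data.Fin.Properties
  using (any?; all?; ¬Fin0; toℕ-fromℕ<; splitAt-↑ˡ; splitAt⁻¹-↑ˡ; splitAt⁻¹-↑ʳ; injective⇒≤)
import Data.Fin.Properties as FinP
open import Data.Fin.Subset using (Subset; ∣_∣; _∈_; _∉_)
open import Data.Fin.Subset.Properties using (_∈?_)
open import Data.List using (List; []; _∷_; map; concatMap; cartesianProductWith; allFin)
import Data.List.Relation.Unary.Any as Any
open import Data.List.Membership.Propositional using () renaming (_∈_ to _∈ₗ_)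
open import Data.List.Membership.Propositional.Properties
  using (∈-map⁺; ∈-concatMap⁺; ∈-cartesianProductWith⁺; ∈-allFin)
open import Data.Maybe using (Maybe; just; nothing; maybe)
open import Data.Nat using (ℕ; zero; suc; _+_; _≤_; _≤?_; z≤n; s≤s)
open import Data.Nat.Properties
  using (≤-refl; ≤-trans; <⇒≤; ≰⇒>; suc-injective; +-assoc; +-comm; +-cancelˡ-≤;
         m≤m⊔n; m≤n⊔m; m≤n+m∸n)
open import Data.Product using (Σ; Σ-syntax; ∃; ∃-syntax; _×_; _,_; proj₁; proj₂)
open import Data.Unit using (⊤; tt)
open import Data.Sum using (_⊎_; inj₁; inj₂; [_,_]′)
open import Data.Vec using (_∷_; here; there)
import Data.Vec.Functional as Tuple
open import Function using (_∘_)
open import Function.Bundles using (_↔_; Inverse; mk↔ₛ′)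
open import Function.Construct.Composition using (_↔-∘_)
open import Function.Construct.Identity using (↔-id)
open import Function.Definitions using (Injective)
open import Relation.Nullary using (¬_; yes; no; Dec; ¬?)
open import Relation.Binary.PropositionalEquality

bool-ext : ∀ {b b' : Bool} → (b ≡ true → b' ≡ true) → (b' ≡ true → b ≡ true) → b ≡ b'
bool-ext {false} {false} _ _ = refl
bool-ext {false} {true}  _ g = g refl
bool-ext {true}  {_}     f _ = sym (f refl)

true≢false : true ≢ false
true≢false ()

∨-true : ∀ {a b} → a ∨ b ≡ true → a ≡ true ⊎ b ≡ true
∨-true {true}  _ = inj₁ refl
∨-true {false} h = inj₂ h

agrees⇒≗ : ∀ {k} a (u c : Fin a → Fin k) → agrees a u c ≡ true → u ≗ c
agrees⇒≗ a u c h with all? (λ i → u i ≟ c i)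
... | yes u≗c = u≗c
agrees⇒≗ a u c () | no _

≗⇒agrees : ∀ {k} a (u c : Fin a → Fin k) → u ≗ c → agrees a u c ≡ true
≗⇒agrees a u c u≗c with all? (λ i → u i ≟ c i)
... | yes _   = refl
... | no u≇c = ⊥-elim (u≇c u≗c)

agrees-cong : ∀ {k} a (u u' c : Fin a → Fin k) → u ≗ u' → agrees a u c ≡ agrees a u' c
agrees-cong a u u' c u≗u' = bool-ext
  (λ h → ≗⇒agrees a u' c (λ i → trans (sym (u≗u' i)) (agrees⇒≗ a u c h i)))
  (λ h → ≗⇒agrees a u c (λ i → trans (u≗u' i) (agrees⇒≗ a u' c h i)))

allJust-cong : ∀ {X : Set} a (u u' : Fin a → Maybe X) → u ≗ u' → allJust a u ≡ allJust a u'
allJust-cong zero    u u' _ = refl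
allJust-cong (suc a) u u' u≗u'
  with u zero | u' zero | u≗u' zero
     | allJust a (u ∘ suc) | allJust a (u' ∘ suc) | allJust-cong a (u ∘ suc) (u' ∘ suc) (u≗u' ∘ suc)
... | x | .x | refl | f | .f | refl = refl

allJust-just : ∀ {X : Set} a (u : Fin a → Maybe X) t → allJust a u ≡ just t → ∀ i → u i ≡ just (t i)
allJust-just (suc a) u t eq i with u zero in e₀ | allJust a (u ∘ suc) in e₁
allJust-just (suc a) u t refl zero    | just x | just f = e₀
allJust-just (suc a) u t refl (suc i) | just x | just f = allJust-just a (u ∘ suc) f e₁ i

allJust-nothing : ∀ {X : Set} a (u : Fin a → Maybe X) → allJust a u ≡ nothing → ∃[ i ] u i ≡ nothing
allJust-nothing (suc a) u eq with u zero in e₀ | allJust a (u ∘ suc) in e₁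
allJust-nothing (suc a) u () | just x  | just f
... | just x  | nothing = let (i , ui) = allJust-nothing a (u ∘ suc) e₁ in suc i , ui
... | nothing | _       = zero , e₀

RelFam : Sig → ℕ → Set
RelFam σ n = (R : Fin (nsym σ)) → (Fin (ar σ R) → Fin n) → Bool

mk : ∀ {σ} n → RelFam σ n → Str σ
mk n r = record { size = n ; rel = r }

-- Tuples are
-- functions, so this is a genuine property; all steps of the construction
-- produce such structures, so the target structure must be one as well.
Extensional : ∀ {σ} → Str σ → Set
Extensional {σ} A = ∀ R (t t' : Fin (ar σ R) → Fin (size A)) → t ≗ t' → rel A R t ≡ rel A R t'

module _ {σ : Sig} where

  addRel-same : (A : Str σ) {k : ℕ} (γ : Col A k) → ∀ R c t
    → rel (addRel A γ R c) R t ≡ (rel A R t ∨ agrees (ar σ R) (γ ∘ t) c)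
  addRel-same A γ R c t with R ≟ R
  ... | yes refl = refl
  ... | no R≢R   = ⊥-elim (R≢R refl)

  addRel-extensional : (A : Str σ) {k : ℕ} (γ : Col A k) → ∀ R c
    → Extensional A → Extensional (addRel A γ R c)
  addRel-extensional A γ R c A-ext R' t t' t≗t' with R' ≟ R
  ... | yes refl = cong₂ _∨_ (A-ext R t t' t≗t')
                             (agrees-cong (ar σ R) (γ ∘ t) (γ ∘ t') c (cong γ ∘ t≗t'))
  ... | no _     = A-ext R' t t' t≗t'

  union-extensional : (A B : Str σ) → Extensional (A ⊔ˢ B)
  union-extensional A B R t t' t≗t' = cong₂ _∨_
    (cong (maybe (rel A R) false) (allJust-cong (ar σ R) _ _ (cong (leftOf (size A) (size B)) ∘ t≗t')))
    (cong (maybe (rel B R) false) (allJust-cong (ar σ R) _ _ (cong (rightOf (size A) (size B)) ∘ t≗t')))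

  ExtensionalCopy : Str σ → Set
  ExtensionalCopy A = Σ[ X ∈ Str σ ] Σ[ e ∈ Fin (size X) ↔ Fin (size A) ]
    ((size X ≡ 0 ⊎ Extensional X) × (∀ R s → rel A R (Inverse.to e ∘ s) ≡ rel X R s))

  ucw⇒extensionalCopy : ∀ {k} {A : Str σ} {γ} → UCW k A γ → ExtensionalCopy A
  ucw⇒extensionalCopy (ucw-empty A γ A-empty) = A , ↔-id _ , inj₁ A-empty , λ _ _ → refl
  ucw⇒extensionalCopy (ucw-single A γ _ rel-false _) =
    A , ↔-id _ , inj₂ (λ R t t' _ → trans (rel-false R t) (sym (rel-false R t'))) , λ _ _ → refl
  ucw⇒extensionalCopy (ucw-union {A} {B} _ _) = A ⊔ˢ B , ↔-id _ , inj₂ (union-extensional A B) , λ _ _ → refl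
  ucw⇒extensionalCopy (ucw-recolour d _) = ucw⇒extensionalCopy d
  ucw⇒extensionalCopy (ucw-addRel {A} {γ} d R c) with ucw⇒extensionalCopy d
  ... | X , e , X-ext , transfer = addRel X γX R c , e , extension X-ext , transfer'
    where
      γX : Fin (size X) → Fin _
      γX = γ ∘ Inverse.to e
      extension : size X ≡ 0 ⊎ Extensional X → size X ≡ 0 ⊎ Extensional (addRel X γX R c)
      extension (inj₁ X-empty) = inj₁ X-empty
      extension (inj₂ X-ext)   = inj₂ (addRel-extensional X γX R c X-ext)
      transfer' : ∀ R' s → rel (addRel A γ R c) R' (Inverse.to e ∘ s) ≡ rel (addRel X γX R c) R' s
      transfer' R' s with R' ≟ R
      ... | yes refl = cong (_∨ agrees (ar σ R) (γX ∘ s) c) (transfer R s)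
      ... | no _     = transfer R' s
  ucw⇒extensionalCopy (ucw-iso d e rel-e _) with ucw⇒extensionalCopy d
  ... | X , e₀ , X-ext , transfer =
    X , e ↔-∘ e₀ , X-ext , λ R s → trans (rel-e R (Inverse.to e₀ ∘ s)) (transfer R s)

  -- A nonempty member of UCW is extensional up to a map that is pointwise the
  -- identity: this is the form in which the construction consumes it.
  record ExtensionalForm (A : Str σ) : Set where
    field
      Y        : RelFam σ (size A)
      Y-ext    : Extensional (mk (size A) Y)
      norm     : Fin (size A) → Fin (size A)
      norm≗id  : ∀ x → norm x ≡ x
      rel-norm : ∀ R t → rel A R (norm ∘ t) ≡ Y R t

  extensionalForm : ∀ {k} {A : Str σ} {γ} → UCW k A γ → Fin (size A) → ExtensionalForm A
  extensionalForm d a with ucw⇒extensionalCopy d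
  ... | X , e , inj₁ X-empty , _ = ⊥-elim (¬Fin0 (subst Fin X-empty (Inverse.from e a)))
  ... | X , e , inj₂ X-ext , transfer = record
    { Y        = λ R t → rel X R (Inverse.from e ∘ t)
    ; Y-ext    = λ R t t' t≗t' → X-ext R _ _ (cong (Inverse.from e) ∘ t≗t')
    ; norm     = Inverse.to e ∘ Inverse.from e
    ; norm≗id  = Inverse.strictlyInverseˡ e
    ; rel-norm = λ R t → transfer R (Inverse.from e ∘ t)
    }

allTuples : ∀ a N → List (Fin a → Fin N)
allTuples zero    N = (λ ()) ∷ []
allTuples (suc a) N = cartesianProductWith Tuple._∷_ (allFin N) (allTuples a N)

allTuples-complete : ∀ a N (t : Fin a → Fin N) → ∃[ u ] (u ∈ₗ allTuples a N × u ≗ t)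
allTuples-complete zero    N t = (λ ()) , Any.here refl , λ ()
allTuples-complete (suc a) N t with allTuples-complete a N (t ∘ suc)
... | u , u∈ , u≗t = t zero Tuple.∷ u
                   , ∈-cartesianProductWith⁺ Tuple._∷_ (∈-allFin (t zero)) u∈
                   , λ { zero → refl ; (suc i) → u≗t i }

-- Let (r₀, γ) be an extensional coloured structure in UCW_k and T ⊇ r₀ a target
-- relation such that a tuple of T missing from r₀ shares its colour pattern
-- only with tuples of T.  Applying rule (5) to the pattern of every such tuple
-- yields T.
module PatternClosure {σ : Sig} {k N : ℕ} (r₀ : RelFam σ N) (γ : Fin N → Fin k)
  (r₀-ext : Extensional (mk N r₀)) (T : RelFam σ N)
  (r₀⊆T : ∀ R t → r₀ R t ≡ true → T R t ≡ true)
  (T-closed : ∀ R t t' → T R t ≡ true → r₀ R t ≡ false → γ ∘ t ≗ γ ∘ t' → T R t' ≡ true) where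

  Job : Set
  Job = Σ[ R ∈ Fin (nsym σ) ] (Fin (ar σ R) → Fin N)

  pending : Job → Bool
  pending (R , t₀) = T R t₀ ∧ not (r₀ R t₀)

  pending⇒ : ∀ R t₀ → pending (R , t₀) ≡ true → T R t₀ ≡ true × r₀ R t₀ ≡ false
  pending⇒ R t₀ h with T R t₀ | r₀ R t₀
  ... | true | false = refl , refl

  ⇒pending : ∀ R t₀ → T R t₀ ≡ true → r₀ R t₀ ≡ false → pending (R , t₀) ≡ true
  ⇒pending R t₀ T-t₀ r₀-t₀ rewrite T-t₀ | r₀-t₀ = refl

  addPattern : RelFam σ N → Job → RelFam σ N
  addPattern r (R , t₀) = if pending (R , t₀) then addRelRel (mk N r) γ R (γ ∘ t₀) else r

  addPatterns : RelFam σ N → List Job → RelFam σ N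
  addPatterns r []       = r
  addPatterns r (j ∷ js) = addPatterns (addPattern r j) js

  addPatterns-ucw : ∀ r js → UCW k (mk N r) γ → UCW k (mk N (addPatterns r js)) γ
  addPatterns-ucw r []             d = d
  addPatterns-ucw r ((R , t₀) ∷ js) d with pending (R , t₀)
  ... | true  = addPatterns-ucw _ js (ucw-addRel d R (γ ∘ t₀))
  ... | false = addPatterns-ucw _ js d

  addPatterns-mono : ∀ r js R t → r R t ≡ true → addPatterns r js R t ≡ true
  addPatterns-mono r []              R t h = h
  addPatterns-mono r ((R₀ , t₀) ∷ js) R t h = addPatterns-mono _ js R t (step h)
    where
      step : r R t ≡ true → addPattern r (R₀ , t₀) R t ≡ true
      step h with pending (R₀ , t₀)
      ... | false = h
      ... | true with R ≟ R₀
      ...   | no _     = h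
      ...   | yes refl rewrite h = refl

  addPatterns-sound : ∀ r js → (∀ R t → r R t ≡ true → T R t ≡ true)
    → ∀ R t → addPatterns r js R t ≡ true → T R t ≡ true
  addPatterns-sound r []              r⊆T = r⊆T
  addPatterns-sound r ((R₀ , t₀) ∷ js) r⊆T = addPatterns-sound _ js step
    where
      step : ∀ R t → addPattern r (R₀ , t₀) R t ≡ true → T R t ≡ true
      step R t h with pending (R₀ , t₀) in p
      ... | false = r⊆T R t h
      ... | true with R ≟ R₀
      ...   | no _     = r⊆T R t h
      ...   | yes refl with ∨-true h
      ...     | inj₁ in-r   = r⊆T R t in-r
      ...     | inj₂ agrees = let (T-t₀ , r₀-t₀) = pending⇒ R t₀ p
                              in T-closed R t₀ t T-t₀ r₀-t₀
                                   (λ i → sym (agrees⇒≗ (ar σ R) (γ ∘ t) (γ ∘ t₀) agrees i))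

  addPatterns-done : ∀ r js R t₀ → (R , t₀) ∈ₗ js → pending (R , t₀) ≡ true
    → ∀ t → γ ∘ t ≗ γ ∘ t₀ → addPatterns r js R t ≡ true
  addPatterns-done r ((R , t₀) ∷ js) R t₀ (Any.here refl) p t same = addPatterns-mono _ js R t added
    where
      added : addPattern r (R , t₀) R t ≡ true
      added rewrite p = trans (addRel-same (mk N r) γ R (γ ∘ t₀) t)
                              (trans (cong (r R t ∨_) (≗⇒agrees (ar σ R) (γ ∘ t) (γ ∘ t₀) same)) (∨-zeroʳ _))
  addPatterns-done r (j ∷ js) R t₀ (Any.there j∈) p = addPatterns-done (addPattern r j) js R t₀ j∈ p

  allJobs : List Job
  allJobs = concatMap (λ R → map (R ,_) (allTuples (ar σ R) N)) (allFin (nsym σ))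

  ∈-allJobs : ∀ R u → u ∈ₗ allTuples (ar σ R) N → (R , u) ∈ₗ allJobs
  ∈-allJobs R u u∈ = ∈-concatMap⁺ (λ R → map (R ,_) (allTuples (ar σ R) N))
    (Any.map (λ { refl → ∈-map⁺ (R ,_) u∈ }) (∈-allFin R))

  closure : UCW k (mk N r₀) γ → Σ[ r ∈ RelFam σ N ] (UCW k (mk N r) γ × (∀ R t → r R t ≡ T R t))
  closure d = addPatterns r₀ allJobs , addPatterns-ucw r₀ allJobs d
            , λ R t → bool-ext (addPatterns-sound r₀ allJobs r₀⊆T R t) (complete R t)
    where
      complete : ∀ R t → T R t ≡ true → addPatterns r₀ allJobs R t ≡ true
      complete R t T-t with r₀ R t in r₀-t
      ... | true  = addPatterns-mono r₀ allJobs R t r₀-t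
      ... | false with allTuples-complete (ar σ R) N t
      ...   | u , u∈ , u≗t = addPatterns-done r₀ allJobs R u (∈-allJobs R u u∈)
                               (⇒pending R u (T-closed R t u T-t r₀-t same) (trans (r₀-ext R u t u≗t) r₀-t))
                               t same
        where
          same : γ ∘ t ≗ γ ∘ u
          same i = cong γ (sym (u≗t i))

rank : ∀ {N} → Subset N → Fin N → ℕ
rank (_     ∷ s) zero    = 0
rank (true  ∷ s) (suc x) = suc (rank s x)
rank (false ∷ s) (suc x) = rank s x

rank<∣s∣ : ∀ {N} (s : Subset N) x → x ∈ s → suc (rank s x) ≤ ∣ s ∣
rank<∣s∣ (true  ∷ s) zero    here       = s≤s z≤n
rank<∣s∣ (true  ∷ s) (suc x) (there x∈) = s≤s (rank<∣s∣ s x x∈)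
rank<∣s∣ (false ∷ s) (suc x) (there x∈) = rank<∣s∣ s x x∈

rank-injective : ∀ {N} (s : Subset N) x y → x ∈ s → y ∈ s → rank s x ≡ rank s y → x ≡ y
rank-injective (_     ∷ s) zero    zero    _          _          _  = refl
rank-injective (true  ∷ s) zero    (suc y) _          _          ()
rank-injective (true  ∷ s) (suc x) zero    _          _          ()
rank-injective (false ∷ s) zero    (suc y) ()         _          _
rank-injective (false ∷ s) (suc x) zero    _          ()         _
rank-injective (true  ∷ s) (suc x) (suc y) (there x∈) (there y∈) eq =
  cong suc (rank-injective s x y x∈ y∈ (suc-injective eq))
rank-injective (false ∷ s) (suc x) (suc y) (there x∈) (there y∈) eq =
  cong suc (rank-injective s x y x∈ y∈ eq)

module BagColouring {N p : ℕ} (B : Subset N) (B≤ : ∣ B ∣ ≤ suc p) where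

  colour : Fin N → Fin (suc (suc p))
  colour u with u ∈? B
  ... | yes u∈ = suc (fromℕ< (≤-trans (rank<∣s∣ B u u∈) B≤))
  ... | no _   = zero

  colour-∉ : ∀ u → u ∉ B → colour u ≡ zero
  colour-∉ u u∉ with u ∈? B
  ... | yes u∈ = ⊥-elim (u∉ u∈)
  ... | no _   = refl

  colour-zero : ∀ u → colour u ≡ zero → u ∉ B
  colour-zero u eq u∈ with u ∈? B | eq
  ... | no u∉ | _ = u∉ u∈

  colour-injective : ∀ u u' → u ∈ B → colour u ≡ colour u' → u ≡ u'
  colour-injective u u' u∈ eq with u ∈? B | u' ∈? B | eq
  ... | no u∉  | _        | _   = ⊥-elim (u∉ u∈)
  ... | yes u∈ | yes u'∈ | eq' = rank-injective B u u' u∈ u'∈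
        (trans (sym (toℕ-fromℕ< _)) (trans (cong toℕ (FinP.suc-injective eq')) (toℕ-fromℕ< _)))

factorise : ∀ {m k} (γ δ : Fin m → Fin k) → (∀ j j' → γ j ≡ γ j' → δ j ≡ δ j')
  → Σ[ g ∈ (Fin k → Fin k) ] (g ∘ γ ≗ δ)
factorise γ δ δ-respects = g , g∘γ≗δ
  where
    g : Fin _ → Fin _
    g c with any? (λ j → γ j ≟ c)
    ... | yes (j , _) = δ j
    ... | no _        = c
    g∘γ≗δ : g ∘ γ ≗ δ
    g∘γ≗δ j with any? (λ j' → γ j' ≟ γ j)
    ... | yes (j' , eq) = δ-respects j' j eq
    ... | no none       = ⊥-elim (none (j , refl))

least : ∀ N {P : Fin N → Set} → (∀ x → Dec (P x)) → (key : Fin N → ℕ) → ∃ P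
  → Σ[ v ∈ Fin N ] (P v × (∀ w → P w → key v ≤ key w))
least (suc N) {P} P? key (v , Pv) with any? (P? ∘ suc)
... | no none with v
...   | zero  = zero , Pv , λ { zero _ → ≤-refl ; (suc w) Pw → ⊥-elim (none (w , Pw)) }
...   | suc w = ⊥-elim (none (w , Pv))
least (suc N) {P} P? key (v , Pv) | yes some with least N (P? ∘ suc) (key ∘ suc) some
... | v' , Pv' , v'-least with P? zero
...   | no ¬P0 = suc v' , Pv' , λ { zero P0 → ⊥-elim (¬P0 P0) ; (suc w) Pw → v'-least w Pw }
...   | yes P0 with key zero ≤? key (suc v')
...     | yes ≤v' = zero , P0 , λ { zero _ → ≤-refl ; (suc w) Pw → ≤-trans ≤v' (v'-least w Pw) }
...     | no ≰v'  = suc v' , Pv' , λ { zero _ → <⇒≤ (≰⇒> ≰v') ; (suc w) Pw → v'-least w Pw }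

Point : ∀ {σ} → Str σ
Point = mk 1 (λ _ _ → false)

extendBy : ∀ {m n} → (Fin m → Fin n) → Fin n → Fin (m + 1) → Fin n
extendBy {m} ι v j = [ ι , (λ _ → v) ]′ (splitAt m j)

extendBy-injective : ∀ {m n} (ι : Fin m → Fin n) v → Injective _≡_ _≡_ ι → (∀ j → ι j ≢ v)
  → Injective _≡_ _≡_ (extendBy ι v)
extendBy-injective {m} ι v ι-inj v-new {j} {j'} eq with splitAt m j in e | splitAt m j' in e'
... | inj₁ x | inj₁ x' = trans (sym (splitAt⁻¹-↑ˡ e)) (trans (cong (_↑ˡ 1) (ι-inj eq)) (splitAt⁻¹-↑ˡ e'))
... | inj₁ x | inj₂ _  = ⊥-elim (v-new x eq)
... | inj₂ _ | inj₁ x' = ⊥-elim (v-new x' (sym eq))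
... | inj₂ zero | inj₂ zero = trans (sym (splitAt⁻¹-↑ʳ e)) (splitAt⁻¹-↑ʳ e')

leftOf-just : ∀ {m} j x → leftOf m 1 j ≡ just x → splitAt m j ≡ inj₁ x
leftOf-just {m} j x eq with splitAt m j
leftOf-just j x refl | inj₁ _ = refl

leftOf-nothing : ∀ {m} j → leftOf m 1 j ≡ nothing → ∃[ y ] splitAt m j ≡ inj₂ y
leftOf-nothing {m} j eq with splitAt m j
leftOf-nothing j refl | inj₂ y = y , refl

module _ {σ : Sig} {m : ℕ} (r : RelFam σ m) (R : Fin (nsym σ)) (t : Fin (ar σ R) → Fin (m + 1)) where

  rel-adjoin : rel (mk m r ⊔ˢ Point) R t ≡ maybe (r R) false (allJust (ar σ R) (leftOf m 1 ∘ t))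
  rel-adjoin = trans (cong (maybe (r R) false (allJust (ar σ R) (leftOf m 1 ∘ t)) ∨_)
                           (no-point (allJust (ar σ R) (rightOf m 1 ∘ t))))
                     (∨-identityʳ _)
    where
      no-point : ∀ {X : Set} (x : Maybe X) → maybe (λ _ → false) false x ≡ false
      no-point (just _) = refl
      no-point nothing  = refl

  AdjoinCases : Set
  AdjoinCases =
      (∃[ t₀ ] ((∀ i → splitAt m (t i) ≡ inj₁ (t₀ i)) × rel (mk m r ⊔ˢ Point) R t ≡ r R t₀))
    ⊎ ((∃[ i ] ∃[ y ] splitAt m (t i) ≡ inj₂ y) × rel (mk m r ⊔ˢ Point) R t ≡ false)

  adjoin-cases : AdjoinCases
  adjoin-cases = cases _ refl
    where
      cases : ∀ x → allJust (ar σ R) (leftOf m 1 ∘ t) ≡ x → AdjoinCases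
      cases (just t₀) e = inj₁ (t₀ , (λ i → leftOf-just (t i) (t₀ i) (allJust-just (ar σ R) _ t₀ e i))
                                   , trans rel-adjoin (cong (maybe (r R) false) e))
      cases nothing e = inj₂ ((let (i , eᵢ) = allJust-nothing (ar σ R) _ e in i , leftOf-nothing (t i) eᵢ)
                             , trans rel-adjoin (cong (maybe (r R) false) e))

module Construction {σ : Sig} (n : ℕ) (Y : RelFam σ n) (Y-ext : Extensional (mk n Y))
  (L p : ℕ) (bag : Fin L → Subset n) (bag≤ : ∀ i → ∣ bag i ∣ ≤ suc p)
  (covers : ∀ x → ∃[ i ] x ∈ bag i)
  (interval : ∀ x (i j l : Fin L) → i Fin.≤ j → j Fin.≤ l → x ∈ bag i → x ∈ bag l → x ∈ bag j)
  (pairs-in-bags : ∀ R t → Y R t ≡ true → ∀ i j → ∃[ l ] (t i ∈ bag l × t j ∈ bag l)) where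

  K : ℕ
  K = suc (suc p)

  module Colour (i : Fin L) = BagColouring (bag i) (bag≤ i)
  open Colour using (colour)

  firstBag : ∀ x → Σ[ i ∈ Fin L ] (x ∈ bag i × (∀ l → x ∈ bag l → i Fin.≤ l))
  firstBag x = least L (λ i → x ∈? bag i) toℕ (covers x)

  first : Fin n → Fin L
  first x = proj₁ (firstBag x)

  first-≤ : ∀ x l → x ∈ bag l → first x Fin.≤ l
  first-≤ x = proj₂ (proj₂ (firstBag x))

  between : ∀ x i l → first x Fin.≤ i → i Fin.≤ l → x ∈ bag l → x ∈ bag i
  between x i l first≤i i≤l = interval x (first x) i l first≤i i≤l (proj₁ (proj₂ (firstBag x)))

  Missing : ∀ {m} → (Fin m → Fin n) → Fin n → Set
  Missing ι w = ∀ j → ι j ≢ w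

  Missing? : ∀ {m} (ι : Fin m → Fin n) w → Dec (Missing ι w)
  Missing? ι w = all? (λ j → ¬? (ι j ≟ w))

  record Stage : Set where
    field
      m         : ℕ
      r         : RelFam σ m
      γ         : Fin m → Fin K
      ucw       : UCW K (mk m r) γ
      ι         : Fin m → Fin n
      ι-inj     : Injective _≡_ _≡_ ι
      induced   : ∀ R t → r R t ≡ Y R (ι ∘ t)
      F         : Fin L
      γ≗rank    : γ ≗ colour F ∘ ι
      added≤F   : ∀ j → first (ι j) Fin.≤ F
      F≤missing : ∀ w → Missing ι w → F Fin.≤ first w

  -- Step (i): moving the current bag forward is a recolouring, since an added
  -- element outside F (colour 0) is outside every later bag as well.
  rebag : (S : Stage) (F' : Fin L) → Stage.F S Fin.≤ F'
    → Σ[ g ∈ (Fin K → Fin K) ] (g ∘ Stage.γ S ≗ colour F' ∘ Stage.ι S)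
  rebag S F' F≤F' = factorise γ (colour F' ∘ ι) respects
    where
      open Stage S
      retired : ∀ j → ι j ∉ bag F → ι j ∉ bag F'
      retired j ∉F ∈F' = ∉F (between (ι j) F F' (added≤F j) F≤F' ∈F')
      respects : ∀ j j' → γ j ≡ γ j' → colour F' (ι j) ≡ colour F' (ι j')
      respects j j' eq with ι j ∈? bag F
      ... | yes ∈F = cong (colour F')
            (Colour.colour-injective F (ι j) (ι j') ∈F (trans (sym (γ≗rank j)) (trans eq (γ≗rank j'))))
      ... | no ∉F = trans (Colour.colour-∉ F' (ι j) (retired j ∉F))
                          (sym (Colour.colour-∉ F' (ι j') (retired j' ∉F')))
        where
          ∉F' : ι j' ∉ bag F
          ∉F' = Colour.colour-zero F (ι j')
                 (trans (sym (γ≗rank j')) (trans (sym eq) (trans (γ≗rank j) (Colour.colour-∉ F (ι j) ∉F))))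

  module Extension (S : Stage) (v : Fin n) (v-missing : Missing (Stage.ι S) v)
                   (v-least : ∀ w → Missing (Stage.ι S) w → first v Fin.≤ first w) where
    open Stage S

    F' : Fin L
    F' = first v

    F≤F' : F Fin.≤ F'
    F≤F' = F≤missing v v-missing

    g : Fin K → Fin K
    g = proj₁ (rebag S F' F≤F')

    ι' : Fin (m + 1) → Fin n
    ι' = extendBy ι v

    ι'-old : ∀ {j x} → splitAt m j ≡ inj₁ x → ι' j ≡ ι x
    ι'-old = cong [ ι , (λ _ → v) ]′

    ι'-new : ∀ {j y} → splitAt m j ≡ inj₂ y → ι' j ≡ v
    ι'-new = cong [ ι , (λ _ → v) ]′

    γ' : Fin (m + 1) → Fin K
    γ' = _⊔ᶜ_ {A = mk m r} {B = Point} (g ∘ γ) (λ _ → colour F' v)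

    adjoined : UCW K (mk m r ⊔ˢ Point) γ'
    adjoined = ucw-union (ucw-recolour ucw g) (ucw-recolour point (λ _ → colour F' v))
      where
        point : UCW K Point (λ _ → zero)
        point = ucw-single Point _ refl (λ _ _ → refl) (λ _ → refl)

    γ'≗rank : γ' ≗ colour F' ∘ ι'
    γ'≗rank j with splitAt m j
    ... | inj₁ x = proj₂ (rebag S F' F≤F') x
    ... | inj₂ _ = refl

    added≤F' : ∀ j → first (ι' j) Fin.≤ F'
    added≤F' j with splitAt m j
    ... | inj₁ x = ≤-trans (added≤F x) F≤F'
    ... | inj₂ _ = ≤-refl

    F'≤missing : ∀ w → Missing ι' w → F' Fin.≤ first w
    F'≤missing w w-missing = v-least w (λ x eq → w-missing (x ↑ˡ 1) (trans (ι'-old (splitAt-↑ˡ m x 1)) eq))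

    old : RelFam σ (m + 1)
    old = rel (mk m r ⊔ˢ Point)

    target : RelFam σ (m + 1)
    target R t = Y R (ι' ∘ t)

    old-cases : ∀ R t → (old R t ≡ target R t) ⊎ (old R t ≡ false × ∃[ i ] ι' (t i) ≡ v)
    old-cases R t with adjoin-cases r R t
    ... | inj₁ (t₀ , old-part , eq) =
          inj₁ (trans eq (trans (induced R t₀) (Y-ext R _ _ (λ i → sym (ι'-old (old-part i))))))
    ... | inj₂ ((i , _ , new-point) , eq) = inj₂ (eq , i , ι'-new new-point)

    old⊆target : ∀ R t → old R t ≡ true → target R t ≡ true
    old⊆target R t h with old-cases R t
    ... | inj₁ eq       = trans (sym eq) h
    ... | inj₂ (eq , _) = ⊥-elim (true≢false (trans (sym h) eq))

    -- A target tuple through v lies in F' (its entries share a bag with v, and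
    -- all of them start at or before F'), where colours are injective; so a
    -- tuple with the same colour pattern has the same image under ι'.
    target-closed : ∀ R t t' → target R t ≡ true → old R t ≡ false → γ' ∘ t ≗ γ' ∘ t'
      → target R t' ≡ true
    target-closed R t t' in-target not-old same with old-cases R t
    ... | inj₁ eq = ⊥-elim (true≢false (trans (sym in-target) (trans (sym eq) not-old)))
    ... | inj₂ (_ , i₀ , at-v) = trans (Y-ext R _ _ (λ i → sym (same-image i))) in-target
      where
        in-F' : ∀ i → ι' (t i) ∈ bag F'
        in-F' i with pairs-in-bags R (ι' ∘ t) in-target i i₀
        ... | l , ∈l , v∈l = between (ι' (t i)) F' l (added≤F' (t i))
                               (first-≤ v l (subst (_∈ bag l) at-v v∈l)) ∈l
        same-image : ∀ i → ι' (t i) ≡ ι' (t' i)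
        same-image i = Colour.colour-injective F' (ι' (t i)) (ι' (t' i)) (in-F' i)
                         (trans (sym (γ'≗rank (t i))) (trans (same i) (γ'≗rank (t' i))))

    closed : Σ[ r' ∈ RelFam σ (m + 1) ] (UCW K (mk (m + 1) r') γ' × (∀ R t → r' R t ≡ target R t))
    closed = PatternClosure.closure old γ' (union-extensional (mk m r) Point) target old⊆target target-closed
               adjoined

    stage : Stage
    stage = record
      { m = m + 1 ; r = proj₁ closed ; γ = γ' ; ucw = proj₁ (proj₂ closed)
      ; ι = ι' ; ι-inj = extendBy-injective ι v ι-inj v-missing ; induced = proj₂ (proj₂ closed)
      ; F = F' ; γ≗rank = γ'≗rank ; added≤F = added≤F' ; F≤missing = F'≤missing }

  progress : (S : Stage) → (∀ w → ∃[ j ] Stage.ι S j ≡ w)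
    ⊎ (Σ[ v ∈ Fin n ] (Missing (Stage.ι S) v × (∀ w → Missing (Stage.ι S) w → first v Fin.≤ first w)))
  progress S with any? (Missing? (Stage.ι S))
  ... | yes some = inj₂ (least n (Missing? (Stage.ι S)) (toℕ ∘ first) some)
  ... | no none  = inj₁ found
    where
      found : ∀ w → ∃[ j ] Stage.ι S j ≡ w
      found w with any? (λ j → Stage.ι S j ≟ w)
      ... | yes hit = hit
      ... | no miss = ⊥-elim (none (w , λ j eq → miss (j , eq)))

  Complete : Set
  Complete = Σ[ S ∈ Stage ] (∀ w → ∃[ j ] Stage.ι S j ≡ w)

  -- Extend until complete; the fuel counts the missing elements, and a stage
  -- never has more than n elements since ι is injective.
  run : ∀ fuel (S : Stage) → Stage.m S + fuel ≡ n → Complete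
  run fuel S m+fuel≡n with progress S
  run _          S _     | inj₁ all-added = S , all-added
  run zero       S m+0≡n | inj₂ (v , v-missing , v-least) =
    ⊥-elim (1≰0 (+-cancelˡ-≤ (Stage.m S) 1 0 m+1≤m+0))
    where
      1≰0 : ¬ 1 ≤ 0
      1≰0 ()
      m+1≤m+0 : Stage.m S + 1 ≤ Stage.m S + 0
      m+1≤m+0 = subst (Stage.m S + 1 ≤_) (sym m+0≡n)
                  (injective⇒≤ (Stage.ι-inj (Extension.stage S v v-missing v-least)))
  run (suc fuel) S m+fuel≡n | inj₂ (v , v-missing , v-least) =
    run fuel (Extension.stage S v v-missing v-least) (trans (+-assoc (Stage.m S) 1 fuel) m+fuel≡n)

  initial : Fin n → Stage
  initial a = record
    { m = 0 ; r = λ R t → Y R (ι₀ ∘ t) ; γ = λ () ; ucw = ucw-empty _ _ refl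
    ; ι = ι₀ ; ι-inj = λ {} ; induced = λ _ _ → refl
    ; F = first v₀ ; γ≗rank = λ () ; added≤F = λ () ; F≤missing = λ w _ → v₀-least w tt }
    where
      ι₀ : Fin 0 → Fin n
      ι₀ ()
      v₀-data : Σ[ v ∈ Fin n ] (⊤ × (∀ w → ⊤ → first v Fin.≤ first w))
      v₀-data = least n (λ _ → yes tt) (toℕ ∘ first) (a , tt)
      v₀ : Fin n
      v₀ = proj₁ v₀-data
      v₀-least : ∀ w → ⊤ → first v₀ Fin.≤ first w
      v₀-least = proj₂ (proj₂ v₀-data)

  complete : Fin n → Complete
  complete a = run n (initial a) refl

bag≤width+1 : ∀ {G} (D : PathDecomposition G) i → ∣ bag D i ∣ ≤ suc (width D)
bag≤width+1 D i = ≤-trans (maxOver-≥ (len D) (λ i → ∣ bag D i ∣) i) (m≤n+m∸n _ 1)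
  where
    maxOver-≥ : ∀ N (f : Fin N → ℕ) i → f i ≤ maxOver N f
    maxOver-≥ (suc N) f zero    = m≤m⊔n (f zero) _
    maxOver-≥ (suc N) f (suc i) = ≤-trans (maxOver-≥ N (f ∘ suc) i) (m≤n⊔m (f zero) _)

-- A nonempty member of some UCW_k lies in UCW_{w+2} for the width w of any path
-- decomposition of its Gaifman graph: run the construction on its extensional
-- form, colour everything 0 and transport along the resulting isomorphism.
nonempty⇒InUCW : ∀ {σ} {k} {A : Str σ} {γ} → UCW k A γ → Fin (size A)
  → (D : PathDecomposition (Gaifman A)) → InUCW (suc (suc (width D))) A
nonempty⇒InUCW {A = A} d a D =
  (λ _ → zero) , (λ _ → refl) , ucw-iso (ucw-recolour ucw (λ _ → zero)) e rel-e (λ _ → refl)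
  where
    open ExtensionalForm (extensionalForm d a)

    -- two entries of a tuple of Y are equal or adjacent in the Gaifman graph
    pairs-in-bags : ∀ R t → Y R t ≡ true → ∀ i j → ∃[ l ] (t i ∈ bag D l × t j ∈ bag D l)
    pairs-in-bags R t in-Y i j with t i ≟ t j
    ... | yes tᵢ≡tⱼ = let (l , ∈l) = covers D (t i) in l , ∈l , subst (_∈ bag D l) tᵢ≡tⱼ ∈l
    ... | no tᵢ≢tⱼ  = edges D (t i) (t j)
            (tᵢ≢tⱼ , R , norm ∘ t , trans (rel-norm R t) in-Y , (i , norm≗id (t i)) , (j , norm≗id (t j)))

    open Construction (size A) Y Y-ext (len D) (width D) (bag D) (bag≤width+1 D) (covers D) (interval D)
                      pairs-in-bags
    open Stage (proj₁ (complete a))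

    preimage : Fin (size A) → Fin m
    preimage x = proj₁ (proj₂ (complete a) x)

    e : Fin m ↔ Fin (size A)
    e = mk↔ₛ′ (norm ∘ ι) preimage
          (λ x → trans (norm≗id _) (proj₂ (proj₂ (complete a) x)))
          (λ j → ι-inj (trans (proj₂ (proj₂ (complete a) (norm (ι j)))) (norm≗id (ι j))))

    rel-e : ∀ R t → rel A R (norm ∘ ι ∘ t) ≡ r R t
    rel-e R t = trans (rel-norm R (ι ∘ t)) (sym (induced R t))

empty-or-inhabited : ∀ n → n ≡ 0 ⊎ Fin n
empty-or-inhabited zero    = inj₁ refl
empty-or-inhabited (suc _) = inj₂ zero

InUCW-pathwidth : ∀ {σ} {k} {A : Str σ} {γ} → UCW k A γ
  → (D : PathDecomposition (Gaifman A)) → InUCW (suc (suc (width D))) A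
InUCW-pathwidth {A = A} d D with empty-or-inhabited (size A)
... | inj₁ empty = (λ a → ⊥-elim (¬Fin0 (subst Fin empty a))) , (λ a → ⊥-elim (¬Fin0 (subst Fin empty a)))
                 , ucw-empty A _ empty
... | inj₂ a     = nonempty⇒InUCW d a D

proposition1 : (σ : Sig) (A : Str σ) (p k : ℕ)
    → IsPathWidth (Gaifman A) p → IsUCW A k → k ≤ p + 2
proposition1 σ A p k ((D , width≡p) , _) ((_ , _ , A∈UCWk) , k-least) =
  k-least (p + 2) (subst (λ K → InUCW K A) (trans (cong (λ w → 2 + w) width≡p) (+-comm 2 p))
                                          (InUCW-pathwidth A∈UCWk D))
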